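{- Let $\xi(\vec{X})$ be a propositional formula over a set $\vec{X}$ of bit-vectors which contains the $32$-bit vectors $\vec{r0}$, $\vec{r1}$ (inputs) and $\vec{r0}'$ (output), and write $\langle \vec{x} \rangle$ for the two's complement signed value of a bit-vector $\vec{x}$. For integers $d_1,\ldots,d_8$, let $\mathrm{Oct}(d_1,\ldots,d_8)$ denote the conjunction of the eight inequalities $\langle\vec{r0}\rangle \le d_1$, $\langle\vec{r1}\rangle \le d_2$, $-\langle\vec{r0}\rangle \le d_3$, $-\langle\vec{r1}\rangle \le d_4$, $\langle\vec{r0}\rangle+\langle\vec{r1}\rangle \le d_5$, $-\langle\vec{r0}\rangle-\langle\vec{r1}\rangle \le d_6$, $-\langle\vec{r0}\rangle+\langle\vec{r1}\rangle \le d_7$, $\langle\vec{r0}\rangle-\langle\vec{r1}\rangle \le d_8$. Suppose an octagonal update of the form $\mathbf{M}\langle d'_1, d_1, \ldots, d_8, -1 \rangle = 0$ has been derived, i.e. $\mathbf{M} = \mathbf{M}_1 \sqcup \cdots \sqcup \mathbf{M}_\ell$, where each $\mathbf{M}_i = [I \mid \langle v'_1, v_1, \ldots, v_8\rangle]$ is the affine system describing a single point $(v'_1,v_1,\ldots,v_8)\in\mathbb{Z}^9$ such that some assignment satisfies $\xi(\vec{X}) \wedge \mathrm{Oct}(v_1,\ldots,v_8)$ with $\langle \vec{r0}'\rangle = v'_1$, and $v'_1$ is the maximal value of $\langle \vec{r0}'\rangle$ over all assignments satisfying $\xi(\vec{X}) \wedge \mathrm{Oct}(v_1,\ldots,v_8)$;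 and $\sqcup$ is the affine join (affine hull). Let $c, c_1, \ldots, c_8$ be constants and suppose moreover that, for all values of $d_1,\ldots,d_8$: (i) for all values of $\langle\vec{r0}\rangle, \langle\vec{r1}\rangle$ such that $\mathrm{Oct}(d_1,\ldots,d_8)$ and $\xi(\vec{X})$ hold, it follows that $\langle \vec{r0}' \rangle \le c + c_1 d_1 + \cdots + c_8 d_8$ holds; and (ii) for all values of $\langle\vec{r0}\rangle, \langle\vec{r1}\rangle$ there exists a value of $\langle\vec{r0}'\rangle$ such that $\mathrm{Oct}(d_1,\ldots,d_8)$, $\xi(\vec{X})$ and $\langle \vec{r0}' \rangle = c + c_1 d_1 + \cdots + c_8 d_8$ hold. Then $\mathbf{M}\langle d'_1, d_1, \ldots, d_8, -1 \rangle = 0 \models d'_1 = c + c_1 d_1 + \cdots + c_8 d_8$, i.e. every solution $(d'_1,d_1,\ldots,d_8)$ of the affine system $\mathbf{M}$ satisfies $d'_1 = c + c_1 d_1 + \cdots + c_8 d_8$.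
   Context: Setting: the semantics of a block of machine instructions, in a fixed mode combination, is encoded as a propositional (bit-blasted) formula $\xi(\vec{X})$ over bit-vectors; $\vec{r0},\vec{r1}$ represent register values on entry and $\vec{r0}'$ the value of register R0 on exit. The signed value of a $w$-bit vector $\vec{x}$ is $\langle\vec{x}\rangle = \sum_{i=0}^{w-2} 2^i \vec{x}[i] - 2^{w-1}\vec{x}[w-1]$. The symbolic constants $d_1,\dots,d_8$ are the bounds of the input octagon, and $d'_1$ is the symbolic bound of the output inequality $\langle\vec{r0}'\rangle \le d'_1$. An affine system $\mathbf{M}$ over variables $\langle d'_1,d_1,\ldots,d_8\rangle$ written $\mathbf{M}\langle d'_1,\ldots,d_8,-1\rangle=0$ denotes the set of solutions of the linear equations given by the rows of $\mathbf{M}$ (last column being the constant); $[I\mid v]$ denotes the system whose unique solution is the vector $v$, and $\mathbf{M}_1\sqcup\mathbf{M}_2$ is the system describing the smallest affine space containing both solution sets. -}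

module Defs where

open import Data.Bool using (Bool; true; false; _∧_; _∨_; not)
open import Data.Nat using (ℕ; zero; suc; _^_)
open import Data.Fin using (Fin; zero; suc; inject₁; fromℕ)
open import Data.Integer as ℤ using (ℤ; +_; _≤_)
open import Data.Rational as ℚ using (ℚ; _/_; 1ℚ; 0ℚ)
open import Data.Product using (_×_; Σ; ∃)
open import Relation.Binary.PropositionalEquality using (_≡_)

data Formula (n : ℕ) : Set where
  tt ff : Formula n
  var   : Fin n → Formula n
  ¬f_   : Formula n → Formula n
  _∧f_ _∨f_ : Formula n → Formula n → Formula n

Assignment : ℕ → Set
Assignment n = Fin n → Bool

⟦_⟧ : ∀ {n} → Formula n → Assignment n → Bool
⟦ tt ⟧ σ = true
⟦ ff ⟧ σ = false
⟦ var x ⟧ σ = σ x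
⟦ ¬f φ ⟧ σ = not (⟦ φ ⟧ σ)
⟦ φ ∧f ψ ⟧ σ = ⟦ φ ⟧ σ ∧ ⟦ ψ ⟧ σ
⟦ φ ∨f ψ ⟧ σ = ⟦ φ ⟧ σ ∨ ⟦ ψ ⟧ σ

_⊨_ : ∀ {n} → Assignment n → Formula n → Set
σ ⊨ φ = ⟦ φ ⟧ σ ≡ true

-- Bit-vectors: a w-bit vector among the variables X is given by the
-- positions of its bits (bit i = least significant for i = 0).

BitVec : ℕ → ℕ → Set
BitVec w n = Fin w → Fin n

bits : ∀ {w n} → BitVec w n → Assignment n → Fin w → Bool
bits x σ i = σ (x i)

bitℤ : Bool → ℤ
bitℤ true  = + 1
bitℤ false = + 0

unsignedVal : (k : ℕ) → (Fin k → Bool) → ℤ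
unsignedVal zero    x = + 0
unsignedVal (suc k) x = bitℤ (x zero) ℤ.+ (+ 2) ℤ.* unsignedVal k (λ i → x (suc i))

signedVal : ∀ {k} → (Fin (suc k) → Bool) → ℤ
signedVal {k} x = unsignedVal k (λ i → x (inject₁ i)) ℤ.- (+ (2 ^ k)) ℤ.* bitℤ (x (fromℕ k))

⟨_⟩[_] : ∀ {k n} → BitVec (suc k) n → Assignment n → ℤ
⟨ x ⟩[ σ ] = signedVal (bits x σ)

-- Octagon Oct(d₁,…,d₈) on the values a = ⟨r0⟩, b = ⟨r1⟩.
-- d i stands for d_{i+1}.

Bounds : Set
Bounds = Fin 8 → ℤ

d₁ d₂ d₃ d₄ d₅ d₆ d₇ d₈ : Fin 8
d₁ = zero
d₂ = suc zero
d₃ = suc (suc zero)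
d₄ = suc (suc (suc zero))
d₅ = suc (suc (suc (suc zero)))
d₆ = suc (suc (suc (suc (suc zero))))
d₇ = suc (suc (suc (suc (suc (suc zero)))))
d₈ = suc (suc (suc (suc (suc (suc (suc zero))))))

Oct : Bounds → ℤ → ℤ → Set
Oct d a b =
  (a ≤ d d₁) × (b ≤ d d₂) × (ℤ.- a ≤ d d₃) × (ℤ.- b ≤ d d₄) ×
  (a ℤ.+ b ≤ d d₅) × (ℤ.- a ℤ.- b ≤ d d₆) × (ℤ.- a ℤ.+ b ≤ d d₇) ×
  (a ℤ.- b ≤ d d₈)

Agree : ∀ {w n} → BitVec w n → Assignment n → Assignment n → Set
Agree x τ σ = ∀ i → bits x τ i ≡ bits x σ i

Reg : ℕ → Set
Reg n = BitVec 32 n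

OctAt : ∀ {n} → Reg n → Reg n → Bounds → Assignment n → Set
OctAt r0 r1 d σ = Oct d ⟨ r0 ⟩[ σ ] ⟨ r1 ⟩[ σ ]

sumℤ : ∀ {k} → (Fin k → ℤ) → ℤ
sumℤ {zero}  f = + 0
sumℤ {suc k} f = f zero ℤ.+ sumℤ (λ i → f (suc i))

sumℚ : ∀ {k} → (Fin k → ℚ) → ℚ
sumℚ {zero}  f = 0ℚ
sumℚ {suc k} f = f zero ℚ.+ sumℚ (λ i → f (suc i))

toℚ : ℤ → ℚ
toℚ z = z / 1

lin : ℤ → (Fin 8 → ℤ) → Bounds → ℤ
lin c cs d = c ℤ.+ sumℤ (λ j → cs j ℤ.* d j)

linℚ : ℤ → (Fin 8 → ℤ) → (Fin 8 → ℚ) → ℚ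
linℚ c cs d = toℚ c ℚ.+ sumℚ (λ j → toℚ (cs j) ℚ.* d j)

IsMaxPoint : ∀ {n} → Formula n → (r0 r1 r0' : Reg n) → ℤ → Bounds → Set
IsMaxPoint ξ r0 r1 r0' v' v =
  (∃ λ σ → σ ⊨ ξ × OctAt r0 r1 v σ × ⟨ r0' ⟩[ σ ] ≡ v') ×
  (∀ σ → σ ⊨ ξ → OctAt r0 r1 v σ → ⟨ r0' ⟩[ σ ] ℤ.≤ v')

-- Solutions of M = M₁ ⊔ ⋯ ⊔ M_ℓ: the affine hull (in ℚ⁹) of the points
-- (pt' i, pt i), i.e. all affine combinations of them.

InAffineHull : ∀ {ℓ} → (pt' : Fin ℓ → ℤ) → (pt : Fin ℓ → Bounds) →
               ℚ → (Fin 8 → ℚ) → Set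
InAffineHull pt' pt e' e =
  Σ (_ → ℚ) λ λs →
    sumℚ λs ≡ 1ℚ ×
    e' ≡ sumℚ (λ i → λs i ℚ.* toℚ (pt' i)) ×
    (∀ j → e j ≡ sumℚ (λ i → λs i ℚ.* toℚ (pt i j)))

-- A maximal point (v'₁, v) witnesses a model of ξ ∧ Oct(v), and (ii) at d = v yields a model
-- of ξ with the same register inputs, hence also of Oct(v), whose output is c + Σ cⱼvⱼ; so
-- maximality gives v'₁ ≥ c + Σ cⱼvⱼ while (i) gives v'₁ ≤ c + Σ cⱼvⱼ. Every generating point of
-- M thus lies on the hyperplane d'₁ = c + Σ cⱼdⱼ, and affine combinations stay on it.
module Submission where

open import Defs
open import Data.Nat using (ℕ; zero; suc; _^_)
open import Data.Fin using (Fin; zero; suc; inject₁; fromℕ)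
open import Data.Integer using (ℤ; _≤_)
import Data.Integer as ℤ
import Data.Integer.Properties as ℤ
import Data.Rational.Properties as ℚ
import Data.Rational.Unnormalised as ℚᵘ
import Data.Rational.Unnormalised.Properties as ℚᵘ
open import Data.Product using (_×_; ∃; _,_)
open import Algebra.Bundles using (CommutativeSemiring; CommutativeRing)
open import Relation.Binary.PropositionalEquality as ≡
  using (_≡_; refl; cong; cong₂; subst; subst₂; module ≡-Reasoning)

unsignedVal-cong : ∀ k {x y : Fin k → _} → (∀ i → x i ≡ y i) → unsignedVal k x ≡ unsignedVal k y
unsignedVal-cong zero    x≗y = refl
unsignedVal-cong (suc k) x≗y =
  cong₂ (λ b u → bitℤ b ℤ.+ ℤ.+ 2 ℤ.* u) (x≗y zero) (unsignedVal-cong k (λ i → x≗y (suc i)))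

signedVal-cong : ∀ k {x y : Fin (suc k) → _} → (∀ i → x i ≡ y i) → signedVal x ≡ signedVal y
signedVal-cong k x≗y =
  cong₂ (λ u b → u ℤ.- ℤ.+ (2 ^ k) ℤ.* bitℤ b)
    (unsignedVal-cong k (λ i → x≗y (inject₁ i))) (x≗y (fromℕ k))

⟨⟩-agree : ∀ {k n} (x : BitVec (suc k) n) {τ σ} → Agree x τ σ → ⟨ x ⟩[ τ ] ≡ ⟨ x ⟩[ σ ]
⟨⟩-agree {k} x = signedVal-cong k

OctAt-agree : ∀ {n} (r0 r1 : Reg n) {d τ σ} → Agree r0 τ σ → Agree r1 τ σ →
              OctAt r0 r1 d σ → OctAt r0 r1 d τ
OctAt-agree r0 r1 {d} {τ} {σ} r0≈ r1≈ =
  subst₂ (Oct d) (≡.sym (⟨⟩-agree r0 {τ} {σ} r0≈)) (≡.sym (⟨⟩-agree r1 {τ} {σ} r1≈))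

maxPoint≡bound : ∀ {n} (ξ : Formula n) (r0 r1 r0' : Reg n) {v' : ℤ} {v : Bounds} (t : ℤ) →
    IsMaxPoint ξ r0 r1 r0' v' v →
    (∀ σ → OctAt r0 r1 v σ → σ ⊨ ξ → ⟨ r0' ⟩[ σ ] ≤ t) →
    (∀ σ → OctAt r0 r1 v σ →
      ∃ λ τ → Agree r0 τ σ × Agree r1 τ σ × τ ⊨ ξ × ⟨ r0' ⟩[ τ ] ≡ t) →
    v' ≡ t
maxPoint≡bound ξ r0 r1 r0' {v'} {v} t ((σ , σ⊨ξ , σ∈Oct , σ↦v') , maximal) bounded attained =
  let τ , r0≈ , r1≈ , τ⊨ξ , τ↦t = attained σ σ∈Oct in
  ℤ.≤-antisym (subst (_≤ t) σ↦v' (bounded σ σ∈Oct σ⊨ξ))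
              (subst (_≤ v') τ↦t (maximal τ τ⊨ξ (OctAt-agree r0 r1 {v} {τ} {σ} r0≈ r1≈ σ∈Oct)))

module AffineCombination {r ℓ} (R : CommutativeSemiring r ℓ) where

  open CommutativeSemiring R renaming (Carrier to A)
  open import Algebra.Properties.Semiring.Sum semiring
  open import Relation.Binary.Reasoning.Setoid setoid

  affine-combination-preserves-affine-equation :
    ∀ {m k} (c : A) (a : Fin k → A) (λs : Fin m → A) (y : Fin m → A) (x : Fin m → Fin k → A) →
    sum λs ≈ 1# →
    (∀ i → y i ≈ c + sum (λ j → a j * x i j)) →
    sum (λ i → λs i * y i) ≈ c + sum (λ j → a j * sum (λ i → λs i * x i j))
  affine-combination-preserves-affine-equation c a λs y x Σλ≈1 onPlane = begin
    sum (λ i → λs i * y i)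
      ≈⟨ sum-cong-≋ (λ i → *-congˡ (onPlane i)) ⟩
    sum (λ i → λs i * (c + sum (λ j → a j * x i j)))
      ≈⟨ sum-cong-≋ (λ i → trans (distribˡ (λs i) c _)
                                 (+-congˡ (*-distribˡ-sum (λs i) (λ j → a j * x i j)))) ⟩
    sum (λ i → λs i * c + sum (λ j → λs i * (a j * x i j)))
      ≈⟨ ∑-distrib-+ (λ i → λs i * c) (λ i → sum (λ j → λs i * (a j * x i j))) ⟩
    sum (λ i → λs i * c) + sum (λ i → sum (λ j → λs i * (a j * x i j)))
      ≈⟨ +-cong (sym (*-distribʳ-sum c λs)) (∑-comm (λ i j → λs i * (a j * x i j))) ⟩
    sum λs * c + sum (λ j → sum (λ i → λs i * (a j * x i j)))
      ≈⟨ +-cong (trans (*-congʳ Σλ≈1) (*-identityˡ c))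
                (sum-cong-≋ (λ j → trans (sum-cong-≋ (λ i → x*[y*z]≈y*[x*z] (λs i) (a j) (x i j)))
                                         (sym (*-distribˡ-sum (a j) (λ i → λs i * x i j))))) ⟩
    c + sum (λ j → a j * sum (λ i → λs i * x i j))
      ∎
    where
    x*[y*z]≈y*[x*z] : ∀ u v w → u * (v * w) ≈ v * (u * w)
    x*[y*z]≈y*[x*z] u v w =
      trans (sym (*-assoc u v w)) (trans (*-congʳ (*-comm u v)) (*-assoc v u w))

open import Data.Rational using (ℚ; toℚᵘ; _+_; _*_)

toℚᵘ-toℚ : ∀ z → toℚᵘ (toℚ z) ℚᵘ.≃ ℚᵘ.mkℚᵘ z 0
toℚᵘ-toℚ z = ℚ.toℚᵘ-fromℚᵘ (ℚᵘ.mkℚᵘ z 0)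

toℚ-homo-+ : ∀ a b → toℚ (a ℤ.+ b) ≡ toℚ a + toℚ b
toℚ-homo-+ a b = ℚ.toℚᵘ-injective (begin
  toℚᵘ (toℚ (a ℤ.+ b))           ≈⟨ toℚᵘ-toℚ (a ℤ.+ b) ⟩
  ℚᵘ.mkℚᵘ (a ℤ.+ b) 0            ≈⟨ ℚᵘ.*≡* (cong₂ (λ p q → (p ℤ.+ q) ℤ.* ℤ.+ 1)
                                      (≡.sym (ℤ.*-identityʳ a)) (≡.sym (ℤ.*-identityʳ b))) ⟩
  ℚᵘ.mkℚᵘ a 0 ℚᵘ.+ ℚᵘ.mkℚᵘ b 0   ≈⟨ ℚᵘ.+-cong (ℚᵘ.≃-sym (toℚᵘ-toℚ a))
                                               (ℚᵘ.≃-sym (toℚᵘ-toℚ b)) ⟩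
  toℚᵘ (toℚ a) ℚᵘ.+ toℚᵘ (toℚ b) ≈⟨ ℚᵘ.≃-sym (ℚ.toℚᵘ-homo-+ (toℚ a) (toℚ b)) ⟩
  toℚᵘ (toℚ a + toℚ b)           ∎)
  where open ℚᵘ.≃-Reasoning

toℚ-homo-* : ∀ a b → toℚ (a ℤ.* b) ≡ toℚ a * toℚ b
toℚ-homo-* a b = ℚ.toℚᵘ-injective (begin
  toℚᵘ (toℚ (a ℤ.* b))           ≈⟨ toℚᵘ-toℚ (a ℤ.* b) ⟩
  ℚᵘ.mkℚᵘ a 0 ℚᵘ.* ℚᵘ.mkℚᵘ b 0   ≈⟨ ℚᵘ.*-cong (ℚᵘ.≃-sym (toℚᵘ-toℚ a))
                                               (ℚᵘ.≃-sym (toℚᵘ-toℚ b)) ⟩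
  toℚᵘ (toℚ a) ℚᵘ.* toℚᵘ (toℚ b) ≈⟨ ℚᵘ.≃-sym (ℚ.toℚᵘ-homo-* (toℚ a) (toℚ b)) ⟩
  toℚᵘ (toℚ a * toℚ b)           ∎)
  where open ℚᵘ.≃-Reasoning

toℚ-sumℤ : ∀ {k} (f : Fin k → ℤ) → toℚ (sumℤ f) ≡ sumℚ (λ i → toℚ (f i))
toℚ-sumℤ {zero}  f = refl
toℚ-sumℤ {suc k} f =
  ≡.trans (toℚ-homo-+ (f zero) _) (cong (toℚ (f zero) +_) (toℚ-sumℤ (λ i → f (suc i))))

open AffineCombination (CommutativeRing.commutativeSemiring ℚ.+-*-commutativeRing)
open import Algebra.Properties.Semiring.Sum (CommutativeRing.semiring ℚ.+-*-commutativeRing)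
  using (sum; sum-cong-≗)

sumℚ≡sum : ∀ {k} (f : Fin k → ℚ) → sumℚ f ≡ sum f
sumℚ≡sum {zero}  f = refl
sumℚ≡sum {suc k} f = cong (f zero +_) (sumℚ≡sum (λ i → f (suc i)))

toℚ-lin : ∀ c cs (d : Bounds) → toℚ (lin c cs d) ≡ linℚ c cs (λ j → toℚ (d j))
toℚ-lin c cs d = ≡.trans (toℚ-homo-+ c _) (cong (toℚ c +_)
  (≡.trans (toℚ-sumℤ (λ j → cs j ℤ.* d j)) (sum-cong-≗ (λ j → toℚ-homo-* (cs j) (d j)))))

theorem4p1 : ∀ {n : ℕ} (ξ : Formula n) (r0 r1 r0' : Reg n)
    (c : ℤ) (cs : Fin 8 → ℤ)
    {ℓ : ℕ} (pt' : Fin ℓ → ℤ) (pt : Fin ℓ → Bounds) →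
    (∀ i → IsMaxPoint ξ r0 r1 r0' (pt' i) (pt i)) →
    (∀ (d : Bounds) (σ : Assignment n) → OctAt r0 r1 d σ → σ ⊨ ξ →
      ⟨ r0' ⟩[ σ ] ≤ lin c cs d) →
    (∀ (d : Bounds) (σ : Assignment n) → OctAt r0 r1 d σ →
      ∃ λ (τ : Assignment n) → Agree r0 τ σ × Agree r1 τ σ ×
        τ ⊨ ξ × ⟨ r0' ⟩[ τ ] ≡ lin c cs d) →
    ∀ (e' : ℚ) (e : Fin 8 → ℚ) → InAffineHull pt' pt e' e →
    e' ≡ linℚ c cs e
theorem4p1 ξ r0 r1 r0' c cs pt' pt maxPoint bounded attained e' e (λs , Σλ≡1 , e'≡ , e≡) = begin
  e'                                    ≡⟨ e'≡ ⟩
  sumℚ (λ i → λs i * toℚ (pt' i))       ≡⟨ sumℚ≡sum (λ i → λs i * toℚ (pt' i)) ⟩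
  sum (λ i → λs i * toℚ (pt' i))        ≡⟨ combination ⟩
  toℚ c + sumℚ (λ j → C j * sum (Λ j))  ≡⟨ cong (toℚ c +_) (sum-cong-≗ λ j →
                                             cong (C j *_) (≡.sym (≡.trans (e≡ j) (sumℚ≡sum (Λ j))))) ⟩
  linℚ c cs e                           ∎
  where
  open ≡-Reasoning
  C : Fin 8 → ℚ
  C j = toℚ (cs j)
  Λ : Fin 8 → Fin _ → ℚ
  Λ j i = λs i * toℚ (pt i j)
  onHyperplane : ∀ i → toℚ (pt' i) ≡ linℚ c cs (λ j → toℚ (pt i j))
  onHyperplane i =
    ≡.trans (cong toℚ (maxPoint≡bound ξ r0 r1 r0' {pt' i} {pt i} (lin c cs (pt i))
                         (maxPoint i) (bounded (pt i)) (attained (pt i))))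
            (toℚ-lin c cs (pt i))
  combination : sum (λ i → λs i * toℚ (pt' i)) ≡ toℚ c + sumℚ (λ j → C j * sum (Λ j))
  combination = affine-combination-preserves-affine-equation (toℚ c) C λs
                  (λ i → toℚ (pt' i)) (λ i j → toℚ (pt i j))
                  (≡.trans (≡.sym (sumℚ≡sum λs)) Σλ≡1) onHyperplane
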